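{- Let $\mathcal L'=\{R_1,R_2\}\subsetneq\mathcal L$ with order $R_1>R_2$, and let $S$ be a set of triangles such that $Forb_c(S)$ is a semi-free amalgamation class with set of solutions $\mathcal L'$, and such that for some $\mathcal L^{\star}\subseteq\mathcal L\setminus\mathcal L'$ and $\hat{\mathcal L}\subseteq\mathcal L\setminus(\mathcal L'\cup\mathcal L^{\star})$: $S$ contains all triangles of the forms $R'R^1R^2$, $R_2R_2R^1$ and $R_2\hat RR^1$, where $R'\in\mathcal L\setminus(\hat{\mathcal L}\cup\{R_2\})$, $R^1,R^2\in\mathcal L^{\star}$, $\hat R\in\hat{\mathcal L}$; and $S$ contains no other triangle having an edge in $R_1$ or having two edges in $R_2$. Then for any $A,B,C\in Forb_c(S)$ with $B\subseteq A,C$, we have $A\otimes_B C\in Forb_c(S)$.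
   Context: $\mathcal L$ is a language of binary relation symbols interpreted as symmetric irreflexive relations; a structure is complete if any two distinct elements $a,b$ are related by exactly one relation, denoted $\mathbf r(a,b)$. A triangle is a complete structure on three points, specified by the multiset of its edge relations. $Forb_c(S)$ is the class of finite complete structures embedding no triangle of $S$. $Forb_c(S)$ is a semi-free amalgamation class with set of solutions $\mathcal L'$ if it is an amalgamation class and for all $A,B,C\in Forb_c(S)$ with $B$ a common substructure there is $D\in Forb_c(S)$ containing copies of $A$ and $C$ intersecting exactly in $B$ such that every relation between an element of $A\setminus B$ and an element of $C\setminus B$ lies in $\mathcal L'$. For $B\subseteq A,C$, $A\otimes_B C$ is the complete structure on the disjoint union of $A,C$ over $B$ extending both, with $\mathbf r(a,c)=R_i$ ($i\in\{1,2\}$) for $a\in A\setminus B$, $c\in C\setminus B$, where $i$ is least such that for no $b\in B$ is the triangle with edges $\mathbf r(a,b),\mathbf r(b,c),R_i$ in $S$ ($R_1$ if $B=\emptyset$). -}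

module Defs where

open import Data.Nat using (ℕ; zero; suc)
open import Data.Fin using (Fin; zero; suc)
open import Data.Bool using (Bool; true; false; _∨_; if_then_else_)
open import Data.Sum using (_⊎_; inj₁; inj₂)
open import Data.Product using (_×_; Σ; ∃; _,_)
open import Relation.Binary.PropositionalEquality using (_≡_; _≢_)
open import Relation.Nullary using (¬_)

Lang : ℕ → Set
Lang n = Fin n

-- A set of triangles is given by a (decidable) membership function on
-- ordered triples of edge labels; a triangle is a multiset of three labels,
-- and the multiset {x,y,z} belongs to S iff some ordering of it is marked.
Triangles : ℕ → Set
Triangles n = Fin n → Fin n → Fin n → Bool

inS : ∀ {n} → Triangles n → Fin n → Fin n → Fin n → Bool
inS S x y z = S x y z ∨ S x z y ∨ S y x z ∨ S y z x ∨ S z x y ∨ S z y x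

Perm3 : ∀ {n} → (Fin n → Fin n → Fin n → Set) → Fin n → Fin n → Fin n → Set
Perm3 P x y z = P x y z ⊎ P x z y ⊎ P y x z ⊎ P y z x ⊎ P z x y ⊎ P z y x

-- A complete structure on carrier X: a labelling of pairs, symmetric.
-- (Diagonal values r x x are irrelevant: they are never used.)
Symmetric : ∀ {n} {X : Set} → (X → X → Fin n) → Set
Symmetric {X = X} r = ∀ (x y : X) → r x y ≡ r y x

Forb : ∀ {n} {X : Set} → Triangles n → (X → X → Fin n) → Set
Forb {X = X} S r =
  ∀ (i j k : X) → i ≢ j → j ≢ k → i ≢ k → inS S (r i j) (r j k) (r i k) ≡ false

anyFin : ∀ {k} → (Fin k → Bool) → Bool
anyFin {zero} f = false
anyFin {suc k} f = f zero ∨ anyFin (λ i → f (suc i))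

-- Finite structures A ⊇ B and C ⊇ B are presented (up to isomorphism) on
-- carriers Fin b ⊎ Fin a and Fin b ⊎ Fin c, where inj₁ is the copy of B.
-- They agree on B:
AgreeOnB : ∀ {n b a c} → (Fin b ⊎ Fin a → Fin b ⊎ Fin a → Fin n)
         → (Fin b ⊎ Fin c → Fin b ⊎ Fin c → Fin n) → Set
AgreeOnB {b = b} rA rC = ∀ (i j : Fin b) → rA (inj₁ i) (inj₁ j) ≡ rC (inj₁ i) (inj₁ j)

-- Carrier of the amalgam: B ⊔ (A∖B) ⊔ (C∖B).
Amal : ℕ → ℕ → ℕ → Set
Amal b a c = Fin b ⊎ (Fin a ⊎ Fin c)

ExtendsA : ∀ {n b a c} → (Fin b ⊎ Fin a → Fin b ⊎ Fin a → Fin n)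
         → (Amal b a c → Amal b a c → Fin n) → Set
ExtendsA {b = b} {a} {c} rA rD = ∀ (u v : Fin b ⊎ Fin a) → rD (emb u) (emb v) ≡ rA u v
  where
  emb : Fin b ⊎ Fin a → Amal b a c
  emb (inj₁ i) = inj₁ i
  emb (inj₂ x) = inj₂ (inj₁ x)

ExtendsC : ∀ {n b a c} → (Fin b ⊎ Fin c → Fin b ⊎ Fin c → Fin n)
         → (Amal b a c → Amal b a c → Fin n) → Set
ExtendsC {b = b} {a} {c} rC rD = ∀ (u v : Fin b ⊎ Fin c) → rD (emb u) (emb v) ≡ rC u v
  where
  emb : Fin b ⊎ Fin c → Amal b a c
  emb (inj₁ i) = inj₁ i
  emb (inj₂ y) = inj₂ (inj₂ y)

-- Forb_c(S) is a semi-free amalgamation class with set of solutions {R₁,R₂}.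
-- (Closure under isomorphism and substructures of Forb_c(S) is automatic,
-- and the strong amalgamation required here implies the amalgamation
-- property; amalgamating over the empty B gives joint embedding.)
SemiFree : ∀ {n} → Triangles n → Fin n → Fin n → Set
SemiFree S R₁ R₂ =
  ∀ (b a c : ℕ) (rA : Fin b ⊎ Fin a → Fin b ⊎ Fin a → Fin _)
    (rC : Fin b ⊎ Fin c → Fin b ⊎ Fin c → Fin _) →
    Symmetric rA → Symmetric rC → AgreeOnB rA rC → Forb S rA → Forb S rC →
    Σ (Amal b a c → Amal b a c → Fin _) λ rD →
      Symmetric rD × Forb S rD × ExtendsA rA rD × ExtendsC rC rD ×
      (∀ (x : Fin a) (y : Fin c) →
         (rD (inj₂ (inj₁ x)) (inj₂ (inj₂ y)) ≡ R₁) ⊎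
         (rD (inj₂ (inj₁ x)) (inj₂ (inj₂ y)) ≡ R₂))

crossRel : ∀ {n b a c} → Triangles n → Fin n → Fin n
         → (Fin b ⊎ Fin a → Fin b ⊎ Fin a → Fin n)
         → (Fin b ⊎ Fin c → Fin b ⊎ Fin c → Fin n) → Fin a → Fin c → Fin n
crossRel S R₁ R₂ rA rC x y =
  if anyFin (λ i → inS S (rA (inj₂ x) (inj₁ i)) (rC (inj₁ i) (inj₂ y)) R₁)
  then R₂ else R₁

tensor : ∀ {n b a c} → Triangles n → Fin n → Fin n
       → (Fin b ⊎ Fin a → Fin b ⊎ Fin a → Fin n)
       → (Fin b ⊎ Fin c → Fin b ⊎ Fin c → Fin n)
       → Amal b a c → Amal b a c → Fin n
tensor S R₁ R₂ rA rC (inj₁ i) (inj₁ j) = rA (inj₁ i) (inj₁ j)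
tensor S R₁ R₂ rA rC (inj₁ i) (inj₂ (inj₁ x)) = rA (inj₁ i) (inj₂ x)
tensor S R₁ R₂ rA rC (inj₁ i) (inj₂ (inj₂ y)) = rC (inj₁ i) (inj₂ y)
tensor S R₁ R₂ rA rC (inj₂ (inj₁ x)) (inj₁ j) = rA (inj₂ x) (inj₁ j)
tensor S R₁ R₂ rA rC (inj₂ (inj₂ y)) (inj₁ j) = rC (inj₂ y) (inj₁ j)
tensor S R₁ R₂ rA rC (inj₂ (inj₁ x)) (inj₂ (inj₁ x')) = rA (inj₂ x) (inj₂ x')
tensor S R₁ R₂ rA rC (inj₂ (inj₂ y)) (inj₂ (inj₂ y')) = rC (inj₂ y) (inj₂ y')
tensor S R₁ R₂ rA rC (inj₂ (inj₁ x)) (inj₂ (inj₂ y)) = crossRel S R₁ R₂ rA rC x y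
tensor S R₁ R₂ rA rC (inj₂ (inj₂ y)) (inj₂ (inj₁ x)) = crossRel S R₁ R₂ rA rC x y

HasR₁Edge : ∀ {n} → Fin n → Fin n → Fin n → Fin n → Set
HasR₁Edge R₁ x y z = x ≡ R₁ ⊎ y ≡ R₁ ⊎ z ≡ R₁

TwoR₂Edges : ∀ {n} → Fin n → Fin n → Fin n → Fin n → Set
TwoR₂Edges R₂ x y z = (x ≡ R₂ × y ≡ R₂) ⊎ (x ≡ R₂ × z ≡ R₂) ⊎ (y ≡ R₂ × z ≡ R₂)

Form1 : ∀ {n} → Fin n → (Fin n → Set) → (Fin n → Set) → Fin n → Fin n → Fin n → Set
Form1 R₂ Star Hat p q s = ¬ Hat p × p ≢ R₂ × Star q × Star s

Form2 : ∀ {n} → Fin n → (Fin n → Set) → Fin n → Fin n → Fin n → Set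
Form2 R₂ Star p q s = p ≡ R₂ × q ≡ R₂ × Star s

Form3 : ∀ {n} → Fin n → (Fin n → Set) → (Fin n → Set) → Fin n → Fin n → Fin n → Set
Form3 R₂ Star Hat p q s = p ≡ R₂ × Hat q × Star s

module Submission where

-- Write T for A ⊗_B C and let D be the amalgam of A and C over B
-- given by semi-freeness, whose cross relations lie in ℒ' = {R₁,R₂}.
-- The two structures agree off the cross pairs (A∖B) × (C∖B), and a cross
-- pair labelled R₂ in T is labelled R₂ in D as well: R₂ is only chosen when
-- some b ∈ B forbids R₁, and then D, which omits S, cannot use R₁ there.
-- A triangle of T lies inside A, inside C, or meets both A∖B and C∖B.
-- Inside A or C it is a triangle of A or C.  Otherwise its third point is
--  * in B: then T avoids S by the very definition of the cross relation;
--  * in A∖B or C∖B: then two of its edges are cross edges.  If both are R₂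
--    the triangle is a triangle of D; if one is R₁, the classification of
--    the triangles of S with an R₁ edge (all of the form R₁R¹R², R¹,R² ∈ ℒ⋆)
--    excludes it, since its other cross edge is in ℒ'.

open import Defs
open import Data.Nat using (ℕ; zero; suc)
open import Data.Fin using (Fin; zero; suc)
open import Data.Bool using (Bool; true; false; _∨_)
open import Data.Bool.Properties using (∨-commutativeMonoid; ∨-conicalˡ; ∨-conicalʳ)
open import Data.Sum using (_⊎_; inj₁; inj₂)
open import Data.Product using (_×_; ∃; _,_; proj₁; proj₂)
open import Data.Empty using (⊥-elim)
open import Function using (_∘_)
open import Relation.Binary.PropositionalEquality
  using (_≡_; _≢_; refl; sym; trans; cong; cong₂; ≢-sym; module ≡-Reasoning)
open import Relation.Nullary using (¬_)
open import Algebra.Solver.CommutativeMonoid ∨-commutativeMonoid using (solve; _⊜_; _⊕_)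

Solution : ∀ {n} → Fin n → Fin n → Fin n → Set
Solution R₁ R₂ w = w ≡ R₁ ⊎ w ≡ R₂

-- Membership of a triangle in S depends only on the multiset of its labels;
-- these two transpositions generate all reorderings.
inS-swap₂₃ : ∀ {n} (S : Triangles n) x y z → inS S x y z ≡ inS S x z y
inS-swap₂₃ S x y z = reorder (S x y z) (S x z y) (S y x z) (S y z x) (S z x y) (S z y x)
  where
  reorder : ∀ p q r s t u → (p ∨ q ∨ r ∨ s ∨ t ∨ u) ≡ (q ∨ p ∨ t ∨ u ∨ r ∨ s)
  reorder = solve 6 (λ p q r s t u → p ⊕ (q ⊕ (r ⊕ (s ⊕ (t ⊕ u))))
                                   ⊜ q ⊕ (p ⊕ (t ⊕ (u ⊕ (r ⊕ s))))) refl

inS-reverse : ∀ {n} (S : Triangles n) x y z → inS S x y z ≡ inS S z y x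
inS-reverse S x y z = reorder (S x y z) (S x z y) (S y x z) (S y z x) (S z x y) (S z y x)
  where
  reorder : ∀ p q r s t u → (p ∨ q ∨ r ∨ s ∨ t ∨ u) ≡ (u ∨ t ∨ s ∨ r ∨ q ∨ p)
  reorder = solve 6 (λ p q r s t u → p ⊕ (q ⊕ (r ⊕ (s ⊕ (t ⊕ u))))
                                   ⊜ u ⊕ (t ⊕ (s ⊕ (r ⊕ (q ⊕ p))))) refl

Spans : ∀ {n} {X : Set} → Triangles n → (X → X → Fin n) → X → X → X → Bool
Spans S r u v w = inS S (r u v) (r v w) (r u w)

module SpansSymmetry {n} {X : Set} (S : Triangles n) {r : X → X → Fin n}
                     (sym-r : Symmetric r) where

  spans-swap₁₂ : ∀ u v w → Spans S r u v w ≡ Spans S r v u w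
  spans-swap₁₂ u v w =
    trans (cong (λ t → inS S t (r v w) (r u w)) (sym-r u v))
          (inS-swap₂₃ S (r v u) (r v w) (r u w))

  spans-swap₂₃ : ∀ u v w → Spans S r u v w ≡ Spans S r u w v
  spans-swap₂₃ u v w =
    trans (inS-reverse S (r u v) (r v w) (r u w))
          (cong (λ t → inS S (r u w) t (r u v)) (sym-r v w))

  -- freeᵢⱼₖ: a triangle-free triple stays triangle-free when reordered by
  -- the positions i j k.
  module _ (u v w : X) (free : Spans S r u v w ≡ false) where
    free₁₃₂ : Spans S r u w v ≡ false
    free₁₃₂ = trans (spans-swap₂₃ u w v) free

    free₂₁₃ : Spans S r v u w ≡ false
    free₂₁₃ = trans (spans-swap₁₂ v u w) free

    free₂₃₁ : Spans S r v w u ≡ false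
    free₂₃₁ = trans (spans-swap₂₃ v w u) free₂₁₃

    free₃₁₂ : Spans S r w u v ≡ false
    free₃₁₂ = trans (spans-swap₁₂ w u v) free₁₃₂

    free₃₂₁ : Spans S r w v u ≡ false
    free₃₂₁ = trans (spans-swap₁₂ w v u) free₂₃₁

image-free : ∀ {n} {X Y : Set} (S : Triangles n) (r : X → X → Fin n)
  (s : Y → Y → Fin n) (e : Y → X) → (∀ p q → r (e p) (e q) ≡ s p q) →
  Forb S s → ∀ p q t → e p ≢ e q → e q ≢ e t → e p ≢ e t →
  Spans S r (e p) (e q) (e t) ≡ false
image-free S r s e restricts forb p q t d₁ d₂ d₃
  rewrite restricts p q | restricts q t | restricts p t =
  forb p q t (d₁ ∘ cong e) (d₂ ∘ cong e) (d₃ ∘ cong e)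

anyFin-false : ∀ {k} (f : Fin k → Bool) → anyFin f ≡ false → ∀ i → f i ≡ false
anyFin-false f none zero = ∨-conicalˡ _ _ none
anyFin-false f none (suc i) = anyFin-false (f ∘ suc) (∨-conicalʳ _ _ none) i

anyFin-true : ∀ {k} (f : Fin k → Bool) → anyFin f ≡ true → ∃ λ i → f i ≡ true
anyFin-true {zero} f ()
anyFin-true {suc k} f some with f zero in f₀
... | true = zero , f₀
... | false with anyFin-true (f ∘ suc) some
...   | i , fi = suc i , fi

perm3-all : ∀ {n} {P : Fin n → Fin n → Fin n → Set} {Q : Fin n → Set} →
  (∀ p q s → P p q s → Q p × Q q × Q s) →
  ∀ {x y z} → Perm3 P x y z → Q x × Q y × Q z
perm3-all all (inj₁ h) = all _ _ _ h
perm3-all all (inj₂ (inj₁ h)) with all _ _ _ h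
... | qx , qz , qy = qx , qy , qz
perm3-all all (inj₂ (inj₂ (inj₁ h))) with all _ _ _ h
... | qy , qx , qz = qx , qy , qz
perm3-all all (inj₂ (inj₂ (inj₂ (inj₁ h)))) with all _ _ _ h
... | qy , qz , qx = qx , qy , qz
perm3-all all (inj₂ (inj₂ (inj₂ (inj₂ (inj₁ h))))) with all _ _ _ h
... | qz , qx , qy = qx , qy , qz
perm3-all all (inj₂ (inj₂ (inj₂ (inj₂ (inj₂ h))))) with all _ _ _ h
... | qz , qy , qx = qx , qy , qz

module Classification {n} (R₁ R₂ : Fin n) (R₁≢R₂ : R₁ ≢ R₂) (S : Triangles n)
  (Star Hat : Fin n → Set)
  (star-new : ∀ x → Star x → x ≢ R₁ × x ≢ R₂)
  (hat-new : ∀ x → Hat x → x ≢ R₁ × x ≢ R₂ × ¬ Star x)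
  (classified : ∀ x y z → inS S x y z ≡ true →
    HasR₁Edge R₁ x y z ⊎ TwoR₂Edges R₂ x y z →
    Perm3 (Form1 R₂ Star Hat) x y z ⊎ Perm3 (Form2 R₂ Star) x y z ⊎
    Perm3 (Form3 R₂ Star Hat) x y z) where

  star-not-R₁ : ∀ {u} → Star u → u ≢ R₁
  star-not-R₁ st = proj₁ (star-new _ st)

  star-not-solution : ∀ {u} → Star u → ¬ Solution R₁ R₂ u
  star-not-solution st (inj₁ isR₁) = proj₁ (star-new _ st) isR₁
  star-not-solution st (inj₂ isR₂) = proj₂ (star-new _ st) isR₂

  form2-avoids-R₁ : ∀ p q s → Form2 R₂ Star p q s → p ≢ R₁ × q ≢ R₁ × s ≢ R₁
  form2-avoids-R₁ _ _ _ (refl , refl , st) = ≢-sym R₁≢R₂ , ≢-sym R₁≢R₂ , star-not-R₁ st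

  form3-avoids-R₁ : ∀ p q s → Form3 R₂ Star Hat p q s → p ≢ R₁ × q ≢ R₁ × s ≢ R₁
  form3-avoids-R₁ _ _ _ (refl , hat , st) =
    ≢-sym R₁≢R₂ , proj₁ (hat-new _ hat) , star-not-R₁ st

  -- In a triangle R'R¹R² containing R₁ at position u, R₁ is the label R',
  -- so both other labels are in ℒ⋆.
  form1-around-R₁ : ∀ {t u v} → u ≡ R₁ → Perm3 (Form1 R₂ Star Hat) t u v → Star t × Star v
  form1-around-R₁ u≡R₁ (inj₁ (_ , _ , su , _)) = ⊥-elim (star-not-R₁ su u≡R₁)
  form1-around-R₁ u≡R₁ (inj₂ (inj₁ (_ , _ , _ , su))) = ⊥-elim (star-not-R₁ su u≡R₁)
  form1-around-R₁ _ (inj₂ (inj₂ (inj₁ (_ , _ , st , sv)))) = st , sv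
  form1-around-R₁ _ (inj₂ (inj₂ (inj₂ (inj₁ (_ , _ , sv , st))))) = st , sv
  form1-around-R₁ u≡R₁ (inj₂ (inj₂ (inj₂ (inj₂ (inj₁ (_ , _ , _ , su)))))) =
    ⊥-elim (star-not-R₁ su u≡R₁)
  form1-around-R₁ u≡R₁ (inj₂ (inj₂ (inj₂ (inj₂ (inj₂ (_ , _ , su , _)))))) =
    ⊥-elim (star-not-R₁ su u≡R₁)

  r₁-triangle : ∀ t u v → inS S t u v ≡ true → u ≡ R₁ → Star t × Star v
  r₁-triangle t u v inS-tuv u≡R₁ with classified t u v inS-tuv (inj₁ (inj₂ (inj₁ u≡R₁)))
  ... | inj₁ form1 = form1-around-R₁ u≡R₁ form1
  ... | inj₂ (inj₁ form2) = ⊥-elim (proj₁ (proj₂ (perm3-all form2-avoids-R₁ form2)) u≡R₁)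
  ... | inj₂ (inj₂ form3) = ⊥-elim (proj₁ (proj₂ (perm3-all form3-avoids-R₁ form3)) u≡R₁)

  r₁-free : ∀ t u v → u ≡ R₁ → Solution R₁ R₂ v → inS S t u v ≡ false
  r₁-free t u v u≡R₁ solution with inS S t u v in inS-tuv
  ... | false = refl
  ... | true with r₁-triangle t u v inS-tuv u≡R₁
  ...   | _ , star-v = ⊥-elim (star-not-solution star-v solution)

pattern base i = inj₁ i
pattern newA x = inj₂ (inj₁ x)
pattern newC y = inj₂ (inj₂ y)

module TensorAgainstAmalgam {n} (R₁ R₂ : Fin n) (S : Triangles n)
  (r₁-free : ∀ t u v → u ≡ R₁ → Solution R₁ R₂ v → inS S t u v ≡ false)
  {b a c : ℕ} (rA : Fin b ⊎ Fin a → Fin b ⊎ Fin a → Fin n)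
  (rC : Fin b ⊎ Fin c → Fin b ⊎ Fin c → Fin n)
  (symA : Symmetric rA) (symC : Symmetric rC) (agree : AgreeOnB rA rC)
  (forbA : Forb S rA) (forbC : Forb S rC)
  (rD : Amal b a c → Amal b a c → Fin n) (symD : Symmetric rD) (forbD : Forb S rD)
  (extA : ExtendsA {c = c} rA rD) (extC : ExtendsC {a = a} rC rD)
  (crossD : ∀ x y → Solution R₁ R₂ (rD (newA x) (newC y))) where

  T : Amal b a c → Amal b a c → Fin n
  T = tensor S R₁ R₂ rA rC

  symT : Symmetric T
  symT (base i) (base j) = symA (inj₁ i) (inj₁ j)
  symT (base i) (newA x) = symA (inj₁ i) (inj₂ x)
  symT (base i) (newC y) = symC (inj₁ i) (inj₂ y)
  symT (newA x) (base j) = symA (inj₂ x) (inj₁ j)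
  symT (newC y) (base j) = symC (inj₂ y) (inj₁ j)
  symT (newA x) (newA x') = symA (inj₂ x) (inj₂ x')
  symT (newC y) (newC y') = symC (inj₂ y) (inj₂ y')
  symT (newA x) (newC y) = refl
  symT (newC y) (newA x) = refl

  open SpansSymmetry S symT

  embA : Fin b ⊎ Fin a → Amal b a c
  embA (inj₁ i) = base i
  embA (inj₂ x) = newA x

  T-on-A : ∀ p q → T (embA p) (embA q) ≡ rA p q
  T-on-A (inj₁ i) (inj₁ j) = refl
  T-on-A (inj₁ i) (inj₂ x) = refl
  T-on-A (inj₂ x) (inj₁ j) = refl
  T-on-A (inj₂ x) (inj₂ x') = refl

  embC : Fin b ⊎ Fin c → Amal b a c
  embC (inj₁ i) = base i
  embC (inj₂ y) = newC y

  T-on-C : ∀ p q → T (embC p) (embC q) ≡ rC p q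
  T-on-C (inj₁ i) (inj₁ j) = agree i j
  T-on-C (inj₁ i) (inj₂ y) = refl
  T-on-C (inj₂ y) (inj₁ j) = refl
  T-on-C (inj₂ y) (inj₂ y') = refl

  blocks : Fin a → Fin c → Fin b → Bool
  blocks x y i = inS S (rA (inj₂ x) (inj₁ i)) (rC (inj₁ i) (inj₂ y)) R₁

  base-in-D : ∀ x i y →
    inS S (rA (inj₂ x) (inj₁ i)) (rC (inj₁ i) (inj₂ y)) (rD (newA x) (newC y)) ≡ false
  base-in-D x i y =
    trans (cong₂ (λ s t → inS S s t (rD (newA x) (newC y)))
                 (sym (extA (inj₂ x) (inj₁ i))) (sym (extC (inj₁ i) (inj₂ y))))
          (forbD (newA x) (base i) (newC y) (λ ()) (λ ()) (λ ()))

  blocked-in-D : ∀ x y → anyFin (blocks x y) ≡ true → rD (newA x) (newC y) ≡ R₂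
  blocked-in-D x y some with anyFin-true (blocks x y) some | crossD x y
  ... | _ | inj₂ isR₂ = isR₂
  ... | i , blocking | inj₁ isR₁
    with trans (sym blocking) (trans (cong (inS S _ _) (sym isR₁)) (base-in-D x i y))
  ...   | ()

  cross-cases : ∀ x y →
    (T (newA x) (newC y) ≡ R₁ × (∀ i → blocks x y i ≡ false)) ⊎
    (T (newA x) (newC y) ≡ R₂ × rD (newA x) (newC y) ≡ R₂)
  cross-cases x y with anyFin (blocks x y) in found
  ... | false = inj₁ (refl , anyFin-false (blocks x y) found)
  ... | true = inj₂ (refl , blocked-in-D x y found)

  base-triangle : ∀ x i y → Spans S T (newA x) (base i) (newC y) ≡ false
  base-triangle x i y with cross-cases x y
  ... | inj₁ (isR₁ , unblocked) = trans (cong (inS S _ _) isR₁) (unblocked i)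
  ... | inj₂ (isR₂ , inD) =
    trans (cong (inS S _ _) (trans isR₂ (sym inD))) (base-in-D x i y)

  Tame : Amal b a c → Amal b a c → Set
  Tame u v = T u v ≡ R₁ ⊎ (T u v ≡ R₂ × rD u v ≡ R₂)

  tame-sym : ∀ {u v} → Tame u v → Tame v u
  tame-sym {u} {v} (inj₁ isR₁) = inj₁ (trans (symT v u) isR₁)
  tame-sym {u} {v} (inj₂ (isR₂ , inD)) =
    inj₂ (trans (symT v u) isR₂ , trans (symD v u) inD)

  tame-solution : ∀ {u v} → Tame u v → Solution R₁ R₂ (T u v)
  tame-solution (inj₁ isR₁) = inj₁ isR₁
  tame-solution (inj₂ (isR₂ , _)) = inj₂ isR₂

  cross-tame : ∀ x y → Tame (newA x) (newC y)
  cross-tame x y with cross-cases x y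
  ... | inj₁ (isR₁ , _) = inj₁ isR₁
  ... | inj₂ inD = inj₂ inD

  -- A triangle with one edge as in D and two tame edges avoids S: an R₁
  -- edge is excluded by r₁-free, otherwise it is a triangle of D.
  two-tame-edges : ∀ u v w → u ≢ v → v ≢ w → u ≢ w →
    T u v ≡ rD u v → Tame v w → Tame u w → Spans S T u v w ≡ false
  two-tame-edges u v w _ _ _ _ (inj₁ vw-R₁) uw =
    r₁-free (T u v) (T v w) (T u w) vw-R₁ (tame-solution uw)
  two-tame-edges u v w _ _ _ _ (inj₂ (vw-R₂ , _)) (inj₁ uw-R₁) =
    trans (inS-swap₂₃ S (T u v) (T v w) (T u w))
          (r₁-free (T u v) (T u w) (T v w) uw-R₁ (inj₂ vw-R₂))
  two-tame-edges u v w d₁ d₂ d₃ uv-in-D (inj₂ (vw-R₂ , vw-in-D)) (inj₂ (uw-R₂ , uw-in-D)) =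
    begin
      inS S (T u v) (T v w) (T u w)
        ≡⟨ cong₂ (inS S (T u v)) (trans vw-R₂ (sym vw-in-D)) (trans uw-R₂ (sym uw-in-D)) ⟩
      inS S (T u v) (rD v w) (rD u w)
        ≡⟨ cong (λ t → inS S t (rD v w) (rD u w)) uv-in-D ⟩
      Spans S rD u v w
        ≡⟨ forbD u v w d₁ d₂ d₃ ⟩
      false
    ∎
    where open ≡-Reasoning

  across : ∀ x v y → newA x ≢ v → v ≢ newC y → Spans S T (newA x) v (newC y) ≡ false
  across x (base i) y _ _ = base-triangle x i y
  across x (newA x') y x≢x' _ =
    two-tame-edges (newA x) (newA x') (newC y) x≢x' (λ ()) (λ ())
      (sym (extA (inj₂ x) (inj₂ x'))) (cross-tame x' y) (cross-tame x y)
  across x (newC y') y _ y'≢y = free₃₁₂ (newC y') (newC y) (newA x)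
    (two-tame-edges (newC y') (newC y) (newA x) y'≢y (λ ()) (λ ())
      (sym (extC (inj₂ y') (inj₂ y))) (tame-sym (cross-tame x y)) (tame-sym (cross-tame x y')))

  inside-A : ∀ p q t → embA p ≢ embA q → embA q ≢ embA t → embA p ≢ embA t →
    Spans S T (embA p) (embA q) (embA t) ≡ false
  inside-A = image-free S T rA embA T-on-A forbA

  inside-C : ∀ p q t → embC p ≢ embC q → embC q ≢ embC t → embC p ≢ embC t →
    Spans S T (embC p) (embC q) (embC t) ≡ false
  inside-C = image-free S T rC embC T-on-C forbC

  -- A triple lies inside A, inside C, or meets both A∖B and C∖B; in the
  -- last case it is a reordering of a triple handled by across.
  tensor-forb : Forb S T
  tensor-forb (base i) (base j) (base k) = inside-A (inj₁ i) (inj₁ j) (inj₁ k)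
  tensor-forb (base i) (base j) (newA z) = inside-A (inj₁ i) (inj₁ j) (inj₂ z)
  tensor-forb (base i) (newA y) (base k) = inside-A (inj₁ i) (inj₂ y) (inj₁ k)
  tensor-forb (newA x) (base j) (base k) = inside-A (inj₂ x) (inj₁ j) (inj₁ k)
  tensor-forb (base i) (newA y) (newA z) = inside-A (inj₁ i) (inj₂ y) (inj₂ z)
  tensor-forb (newA x) (base j) (newA z) = inside-A (inj₂ x) (inj₁ j) (inj₂ z)
  tensor-forb (newA x) (newA y) (base k) = inside-A (inj₂ x) (inj₂ y) (inj₁ k)
  tensor-forb (newA x) (newA y) (newA z) = inside-A (inj₂ x) (inj₂ y) (inj₂ z)
  tensor-forb (base i) (base j) (newC z) = inside-C (inj₁ i) (inj₁ j) (inj₂ z)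
  tensor-forb (base i) (newC y) (base k) = inside-C (inj₁ i) (inj₂ y) (inj₁ k)
  tensor-forb (newC x) (base j) (base k) = inside-C (inj₂ x) (inj₁ j) (inj₁ k)
  tensor-forb (base i) (newC y) (newC z) = inside-C (inj₁ i) (inj₂ y) (inj₂ z)
  tensor-forb (newC x) (base j) (newC z) = inside-C (inj₂ x) (inj₁ j) (inj₂ z)
  tensor-forb (newC x) (newC y) (base k) = inside-C (inj₂ x) (inj₂ y) (inj₁ k)
  tensor-forb (newC x) (newC y) (newC z) = inside-C (inj₂ x) (inj₂ y) (inj₂ z)
  tensor-forb (newA x) v (newC y) d₁ d₂ _ = across x v y d₁ d₂
  tensor-forb (newC y) v (newA x) d₁ d₂ _ = free₃₂₁ (newA x) v (newC y) (across x v y (≢-sym d₂) (≢-sym d₁))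
  tensor-forb (newA x) (newC y) w _ d₂ d₃ = free₁₃₂ (newA x) w (newC y) (across x w y d₃ (≢-sym d₂))
  tensor-forb (newC y) (newA x) w _ d₂ d₃ = free₃₁₂ (newA x) w (newC y) (across x w y d₂ (≢-sym d₃))
  tensor-forb u (newA x) (newC y) d₁ _ d₃ = free₂₁₃ (newA x) u (newC y) (across x u y (≢-sym d₁) d₃)
  tensor-forb u (newC y) (newA x) d₁ _ d₃ = free₂₃₁ (newA x) u (newC y) (across x u y (≢-sym d₃) d₁)

lemma6p5 : (n : ℕ) (R₁ R₂ : Fin n) → R₁ ≢ R₂ → (∃ λ R → R ≢ R₁ × R ≢ R₂) →
    (S : Triangles n) → SemiFree S R₁ R₂ →
    (Star Hat : Fin n → Set) →
    (∀ x → Star x → x ≢ R₁ × x ≢ R₂) →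
    (∀ x → Hat x → x ≢ R₁ × x ≢ R₂ × ¬ Star x) →
    (∀ p q s → Form1 R₂ Star Hat p q s → inS S p q s ≡ true) →
    (∀ p q s → Form2 R₂ Star p q s → inS S p q s ≡ true) →
    (∀ p q s → Form3 R₂ Star Hat p q s → inS S p q s ≡ true) →
    (∀ x y z → inS S x y z ≡ true → HasR₁Edge R₁ x y z ⊎ TwoR₂Edges R₂ x y z →
      Perm3 (Form1 R₂ Star Hat) x y z ⊎ Perm3 (Form2 R₂ Star) x y z ⊎
      Perm3 (Form3 R₂ Star Hat) x y z) →
    (b a c : ℕ) (rA : Fin b ⊎ Fin a → Fin b ⊎ Fin a → Fin n)
    (rC : Fin b ⊎ Fin c → Fin b ⊎ Fin c → Fin n) →
    Symmetric rA → Symmetric rC → AgreeOnB rA rC → Forb S rA → Forb S rC →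
    Forb S (tensor S R₁ R₂ rA rC)
lemma6p5 n R₁ R₂ R₁≢R₂ _ S semiFree Star Hat star-new hat-new _ _ _ classified
         b a c rA rC symA symC agree forbA forbC
  with semiFree b a c rA rC symA symC agree forbA forbC
... | rD , symD , forbD , extA , extC , crossD =
  TensorAgainstAmalgam.tensor-forb R₁ R₂ S r₁-free rA rC symA symC agree forbA forbC
    rD symD forbD extA extC crossD
  where
  open Classification R₁ R₂ R₁≢R₂ S Star Hat star-new hat-new classified using (r₁-free)
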